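{- Let $k \le n$ be positive integers and $t$ an integer with $t \leq \binom{n-1}{k-1}$, and let $S \subseteq [n]$ be a $k$-set with $1 \in S$. If $L_k(S) + g(n-k,k) \geq t$, then every vector $\mathbf{x} \in F_n$ with $s_k(\mathbf{x}) < t$ satisfies $\sum_{i\in S} x_i < 0$.
   Context: $[n]=\{1,\dots,n\}$. For $\mathbf{x}=(x_1,\dots,x_n)\in\mathbb{R}^n$ and a $k$-set $S\subseteq[n]$, write $\sigma_S(\mathbf{x}) = \sum_{i\in S} x_i$, and let $s_k(\mathbf{x})$ be the number of $k$-subsets $S$ of $[n]$ with $\sigma_S(\mathbf{x}) \geq 0$. $F_n$ is the set of $\mathbf{x}\in\mathbb{R}^n$ with $\sum_{i=1}^n x_i \geq 0$ and $x_1 \geq x_2 \geq \cdots \geq x_n$. For an integer $m\ge 0$, $g(m,k)$ is the minimum of $s_k(\mathbf{y})$ over all $\mathbf{y}\in\mathbb{R}^m$ with nonnegative coordinate sum (with $s_k$ counting $k$-subsets of $[m]$; this is $0$ if $m<k$). For $k$-sets $T = \{j_1 < \cdots < j_k\}$ and $S = \{i_1<\cdots<i_k\}$ of $[n]$, write $T \succeq S$ if $j_\ell \leq i_\ell$ for all $\ell \in \{1,\dots,k\}$. $L_k(S)$ is the number of $k$-subsets $T$ of $[n]$ with $T \succeq S$.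
   Formalization: The vectors in $F_n$ and the vectors $\mathbf{y}$ over which $g(n-k,k)$ is taken as a minimum have rational rather than real coordinates. -}

module Defs where

open import Data.Nat as ℕ using (ℕ; zero; suc)
open import Data.Fin using (Fin; toℕ) renaming (zero to fz; suc to fs)
open import Data.Fin.Subset using (Subset; inside; outside; ∣_∣; _∈_)
open import Data.Vec using (Vec; []; _∷_)
open import Data.List using (List; []; _∷_; _++_; map; filter; length)
open import Data.List.Relation.Binary.Pointwise using (Pointwise)
import Data.List.Relation.Binary.Pointwise.Properties as PW
open import Data.Rational as ℚ using (ℚ; 0ℚ; _+_; _≤_; _≤?_)
open import Data.Integer as ℤ using (ℤ)
open import Data.Product using (Σ; _×_; _,_)
open import Data.Empty using (⊥)
open import Relation.Binary.PropositionalEquality using (_≡_)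
open import Relation.Nullary.Decidable using (Dec)
open import Relation.Unary using (Pred; Decidable)
open import Data.Bool using (true; false)
open import Level using (0ℓ)

-- all subsets of [n] (a subset is a Vec of inside/outside; coordinate i ↔ element i+1)
allSubsets : (n : ℕ) → List (Subset n)
allSubsets zero    = [] ∷ []
allSubsets (suc n) = map (inside ∷_) (allSubsets n) ++ map (outside ∷_) (allSubsets n)

kSubsets : (n k : ℕ) → List (Subset n)
kSubsets n k = filter (λ S → ∣ S ∣ ℕ.≟ k) (allSubsets n)

σ : {n : ℕ} → Subset n → (Fin n → ℚ) → ℚ
σ []             x = 0ℚ
σ (inside ∷ S)   x = x fz + σ S (λ i → x (fs i))
σ (outside ∷ S)  x = σ S (λ i → x (fs i))

total : {n : ℕ} → (Fin n → ℚ) → ℚ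
total {zero}  x = 0ℚ
total {suc n} x = x fz + total (λ i → x (fs i))

s : (k : ℕ) {n : ℕ} → (Fin n → ℚ) → ℕ
s k {n} x = length (filter (λ S → 0ℚ ≤? σ S x) (kSubsets n k))

InF : {n : ℕ} → (Fin n → ℚ) → Set
InF {n} x = (0ℚ ≤ total x) × ((i j : Fin n) → toℕ i ℕ.≤ toℕ j → x j ≤ x i)

IsG : (m k G : ℕ) → Set
IsG m k G =
  Σ (Fin m → ℚ) (λ y → (0ℚ ≤ total y) × (s k y ≡ G))
  × ((y : Fin m → ℚ) → 0ℚ ≤ total y → G ℕ.≤ s k y)

-- elements of a subset, as an increasing list of positions (0-based)
elems : {n : ℕ} → Subset n → List ℕ
elems []            = []
elems (inside ∷ S)  = 0 ∷ map suc (elems S)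
elems (outside ∷ S) = map suc (elems S)

_⪰_ : {n : ℕ} → Subset n → Subset n → Set
T ⪰ S = Pointwise ℕ._≤_ (elems T) (elems S)

_⪰?_ : {n : ℕ} → (T S : Subset n) → Dec (T ⪰ S)
T ⪰? S = PW.decidable ℕ._≤?_ (elems T) (elems S)

L : (k : ℕ) {n : ℕ} → Subset n → ℕ
L k {n} S = length (filter (λ T → T ⪰? S) (kSubsets n k))

OneIn : {n : ℕ} → Subset n → Set
OneIn []            = ⊥
OneIn (b ∷ _)       = b ≡ inside

{-# OPTIONS --safe #-}
module Submission where

-- Suppose σ_S(x) ≥ 0 and split the k-sets by whether they contain the first (largest)
-- coordinate. Every T ⪰ S contains it and, x being non-increasing, has σ_T ≥ σ_S ≥ 0,
-- so at least L_k(S) nonnegative k-sets contain it. If every k-set containing it is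
-- nonnegative, there are C(n-1,k-1) ≥ t of them. Otherwise some such set is negative;
-- since the total sum is nonnegative, its complement, an (n-k)-set, has nonnegative sum,
-- and the k-subsets of that complement supply at least g(n-k,k) further nonnegative k-sets,
-- so s_k(x) ≥ L_k(S) + g(n-k,k) ≥ t.

open import Defs
open import Data.Nat using (ℕ; _≤_; _∸_)
open import Data.Nat.Combinatorics using (_C_)
open import Data.Integer using (ℤ; +_; _+_) renaming (_≤_ to _≤ℤ_; _<_ to _<ℤ_)
open import Data.Fin using (Fin)
open import Data.Fin.Subset using (Subset; ∣_∣)
open import Data.Rational using (ℚ; 0ℚ) renaming (_<_ to _<ℚ_)
open import Relation.Binary.PropositionalEquality using (_≡_)

open import Algebra.Bundles using (CommutativeMonoid)
import Algebra.Properties.CommutativeSemigroup as CommSemigroupProperties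
open import Data.Bool using (true; false; if_then_else_)
open import Data.Fin using (toℕ) renaming (zero to fz; suc to fs)
open import Data.Fin.Subset using (inside; outside; ∁)
open import Data.Fin.Subset.Properties using (anySubset?; ∣∁p∣≡n∸∣p∣)
open import Data.Integer using (+≤+)
import Data.Integer.Properties as ℤ
open import Data.List using (List; []; _∷_; _++_; map; filter; length)
import Data.List.Properties as List
open import Data.List.Relation.Binary.Pointwise using (Pointwise; []; _∷_)
open import Data.Nat as ℕ using (zero; suc; z≤n; s≤s; _≟_)
open import Data.Nat.Combinatorics using (nCk+nC[k+1]≡[n+1]C[k+1])
open import Data.Nat.Combinatorics.Specification using (k>n⇒nCk≡0)
open import Data.Nat.ListAction using (sum)
open import Data.Nat.ListAction.Properties using (sum-++)
import Data.Nat.Properties as ℕ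
import Data.Rational as ℚ
import Data.Rational.Properties as ℚ
open import Data.Vec using ([]; _∷_)
open import Data.Product using (_×_; _,_; proj₂; map₂)
open import Function using (_∘_)
open import Level using (0ℓ)
open import Relation.Binary.PropositionalEquality
  using (refl; sym; trans; cong; cong₂; subst; subst₂; module ≡-Reasoning)
open import Relation.Nullary using (Dec; yes; no; does; ¬_; contradiction)
open import Relation.Nullary.Decidable using (_×-dec_)
open import Relation.Unary using (Pred; Decidable)

indicator : ∀ {A : Set} → Dec A → ℕ
indicator a? = if does a? then 1 else 0

indicator-mono : ∀ {A B : Set} → (A → B) → (a? : Dec A) (b? : Dec B) → indicator a? ≤ indicator b?
indicator-mono f (no _)  _       = z≤n
indicator-mono f (yes _) (yes _) = ℕ.≤-refl
indicator-mono f (yes a) (no ¬b) = contradiction (f a) ¬b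

indicator-≡0 : ∀ {A : Set} → ¬ A → (a? : Dec A) → indicator a? ≡ 0
indicator-≡0 ¬a (no _)  = refl
indicator-≡0 ¬a (yes a) = contradiction a ¬a

length-filter-filter : ∀ {A : Set} {P Q : Pred A 0ℓ} (P? : Decidable P) (Q? : Decidable Q) (xs : List A) →
  length (filter P? (filter Q? xs)) ≡ sum (map (λ a → indicator (Q? a ×-dec P? a)) xs)
length-filter-filter P? Q? [] = refl
length-filter-filter P? Q? (a ∷ xs) with does (Q? a)
... | false = length-filter-filter P? Q? xs
... | true with does (P? a)
...   | false = length-filter-filter P? Q? xs
...   | true  = cong suc (length-filter-filter P? Q? xs)

count : (m : ℕ) {P : Pred (Subset m) 0ℓ} → Decidable P → ℕ
count zero    P? = indicator (P? [])
count (suc m) P? = count m (P? ∘ (inside ∷_)) ℕ.+ count m (P? ∘ (outside ∷_))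

sum-indicator-allSubsets : ∀ m {P : Pred (Subset m) 0ℓ} (P? : Decidable P) →
  sum (map (indicator ∘ P?) (allSubsets m)) ≡ count m P?
sum-indicator-allSubsets zero    P? = ℕ.+-identityʳ _
sum-indicator-allSubsets (suc m) P? = begin
    sum (map h (map (inside ∷_) A ++ map (outside ∷_) A))
  ≡⟨ cong sum (List.map-++ h (map (inside ∷_) A) (map (outside ∷_) A)) ⟩
    sum (map h (map (inside ∷_) A) ++ map h (map (outside ∷_) A))
  ≡⟨ sum-++ (map h (map (inside ∷_) A)) _ ⟩
    sum (map h (map (inside ∷_) A)) ℕ.+ sum (map h (map (outside ∷_) A))
  ≡⟨ cong₂ ℕ._+_ (cong sum (sym (List.map-∘ A))) (cong sum (sym (List.map-∘ A))) ⟩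
    sum (map (h ∘ (inside ∷_)) A) ℕ.+ sum (map (h ∘ (outside ∷_)) A)
  ≡⟨ cong₂ ℕ._+_ (sum-indicator-allSubsets m _) (sum-indicator-allSubsets m _) ⟩
    count (suc m) P? ∎
  where
  open ≡-Reasoning
  A = allSubsets m
  h = indicator ∘ P?

length-filter-kSubsets : ∀ n k {P : Pred (Subset n) 0ℓ} (P? : Decidable P) →
  length (filter P? (kSubsets n k)) ≡ count n (λ T → (∣ T ∣ ≟ k) ×-dec P? T)
length-filter-kSubsets n k P? =
  trans (length-filter-filter P? _ (allSubsets n)) (sum-indicator-allSubsets n _)

count-mono : ∀ m {P Q : Pred (Subset m) 0ℓ} (P? : Decidable P) (Q? : Decidable Q) →
  (∀ V → P V → Q V) → count m P? ≤ count m Q?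
count-mono zero    P? Q? P⇒Q = indicator-mono (P⇒Q []) (P? []) (Q? [])
count-mono (suc m) P? Q? P⇒Q = ℕ.+-mono-≤
  (count-mono m _ _ (P⇒Q ∘ (inside ∷_)))
  (count-mono m _ _ (P⇒Q ∘ (outside ∷_)))

count-≡0 : ∀ m {P : Pred (Subset m) 0ℓ} (P? : Decidable P) → (∀ V → ¬ P V) → count m P? ≡ 0
count-≡0 zero    P? ¬P = indicator-≡0 (¬P []) (P? [])
count-≡0 (suc m) P? ¬P =
  cong₂ ℕ._+_ (count-≡0 m _ (¬P ∘ (inside ∷_))) (count-≡0 m _ (¬P ∘ (outside ∷_)))

count-cong : ∀ m {P Q : Pred (Subset m) 0ℓ} (P? : Decidable P) (Q? : Decidable Q) →
  (∀ V → does (P? V) ≡ does (Q? V)) → count m P? ≡ count m Q?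
count-cong zero    P? Q? eq = cong (λ b → if b then 1 else 0) (eq [])
count-cong (suc m) P? Q? eq =
  cong₂ ℕ._+_ (count-cong m _ _ (eq ∘ (inside ∷_))) (count-cong m _ _ (eq ∘ (outside ∷_)))

count-size : ∀ m j → count m (λ V → ∣ V ∣ ≟ j) ≡ m C j
count-size zero    zero    = refl
count-size zero    (suc j) = sym (k>n⇒nCk≡0 {0} {suc j} (s≤s z≤n))
count-size (suc m) zero    =
  trans (cong (ℕ._+ count m (λ V → ∣ V ∣ ≟ 0)) (count-≡0 m _ (λ V ()))) (count-size m 0)
-- ∣ inside ∷ V ∣ ≟ suc j and ∣ V ∣ ≟ j are different proofs, but they agree on `does`.
count-size (suc m) (suc j) = trans
  (cong₂ ℕ._+_ (trans (count-cong m (λ V → ∣ inside ∷ V ∣ ≟ suc j) (λ V → ∣ V ∣ ≟ j) (λ V → refl))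
                      (count-size m j))
               (count-size m (suc j)))
  (nCk+nC[k+1]≡[n+1]C[k+1] m j)

lift : ∀ {m} (W : Subset m) → Subset ∣ W ∣ → Subset m
lift []            []      = []
lift (inside  ∷ W) (b ∷ U) = b ∷ lift W U
lift (outside ∷ W) U       = outside ∷ lift W U

restrict : ∀ {m} (W : Subset m) → (Fin m → ℚ) → Fin ∣ W ∣ → ℚ
restrict (inside  ∷ W) x fz     = x fz
restrict (inside  ∷ W) x (fs i) = restrict W (x ∘ fs) i
restrict (outside ∷ W) x i      = restrict W (x ∘ fs) i

∣lift∣ : ∀ {m} (W : Subset m) (U : Subset ∣ W ∣) → ∣ lift W U ∣ ≡ ∣ U ∣
∣lift∣ []            []            = refl
∣lift∣ (inside  ∷ W) (inside  ∷ U) = cong suc (∣lift∣ W U)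
∣lift∣ (inside  ∷ W) (outside ∷ U) = ∣lift∣ W U
∣lift∣ (outside ∷ W) U             = ∣lift∣ W U

σ-lift : ∀ {m} (W : Subset m) (U : Subset ∣ W ∣) (x : Fin m → ℚ) → σ (lift W U) x ≡ σ U (restrict W x)
σ-lift []            []            x = refl
σ-lift (inside  ∷ W) (inside  ∷ U) x = cong (x fz ℚ.+_) (σ-lift W U (x ∘ fs))
σ-lift (inside  ∷ W) (outside ∷ U) x = σ-lift W U (x ∘ fs)
σ-lift (outside ∷ W) U             x = σ-lift W U (x ∘ fs)

total-restrict : ∀ {m} (W : Subset m) (x : Fin m → ℚ) → total (restrict W x) ≡ σ W x
total-restrict []            x = refl
total-restrict (inside  ∷ W) x = cong (x fz ℚ.+_) (total-restrict W (x ∘ fs))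
total-restrict (outside ∷ W) x = total-restrict W (x ∘ fs)

count-lift : ∀ {m} (W : Subset m) {P : Pred (Subset m) 0ℓ} (P? : Decidable P) →
  count ∣ W ∣ (P? ∘ lift W) ≤ count m P?
count-lift []            P? = ℕ.≤-refl
count-lift (inside  ∷ W) P? = ℕ.+-mono-≤ (count-lift W _) (count-lift W _)
count-lift {suc m} (outside ∷ W) P? =
  ℕ.≤-trans (count-lift W _) (ℕ.m≤n+m _ (count m (P? ∘ (inside ∷_))))

total≡σ+σ∁ : ∀ {m} (V : Subset m) (x : Fin m → ℚ) → total x ≡ σ V x ℚ.+ σ (∁ V) x
total≡σ+σ∁ []            x = sym (ℚ.+-identityˡ 0ℚ)
total≡σ+σ∁ (inside  ∷ V) x =
  trans (cong (x fz ℚ.+_) (total≡σ+σ∁ V (x ∘ fs))) (sym (ℚ.+-assoc (x fz) _ _))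
total≡σ+σ∁ (outside ∷ V) x =
  trans (cong (x fz ℚ.+_) (total≡σ+σ∁ V (x ∘ fs))) (x∙yz≈y∙xz (x fz) (σ V (x ∘ fs)) (σ (∁ V) (x ∘ fs)))
  where open CommSemigroupProperties (CommutativeMonoid.commutativeSemigroup ℚ.+-0-commutativeMonoid)

sumMap : (ℕ → ℚ) → List ℕ → ℚ
sumMap f []       = 0ℚ
sumMap f (a ∷ as) = f a ℚ.+ sumMap f as

sumMap-map-suc : ∀ (f : ℕ → ℚ) as → sumMap f (map suc as) ≡ sumMap (f ∘ suc) as
sumMap-map-suc f []       = refl
sumMap-map-suc f (a ∷ as) = cong (f (suc a) ℚ.+_) (sumMap-map-suc f as)

σ≡sumMap-elems : ∀ {n} (T : Subset n) (x : Fin n → ℚ) (f : ℕ → ℚ) →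
  (∀ i → x i ≡ f (toℕ i)) → σ T x ≡ sumMap f (elems T)
σ≡sumMap-elems []            x f x≡f = refl
σ≡sumMap-elems (inside  ∷ T) x f x≡f = cong₂ ℚ._+_ (x≡f fz)
  (trans (σ≡sumMap-elems T (x ∘ fs) (f ∘ suc) (x≡f ∘ fs)) (sym (sumMap-map-suc f (elems T))))
σ≡sumMap-elems (outside ∷ T) x f x≡f =
  trans (σ≡sumMap-elems T (x ∘ fs) (f ∘ suc) (x≡f ∘ fs)) (sym (sumMap-map-suc f (elems T)))

sumMap-antitone : ∀ (f : ℕ → ℚ) → (∀ {i j} → i ≤ j → f j ℚ.≤ f i) →
  ∀ {as bs} → Pointwise _≤_ as bs → sumMap f bs ℚ.≤ sumMap f as
sumMap-antitone f anti []         = ℚ.≤-refl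
sumMap-antitone f anti (a≤b ∷ ps) = ℚ.+-mono-≤ (anti a≤b) (sumMap-antitone f anti ps)

clamp : ∀ m → ℕ → Fin (suc m)
clamp zero    _       = fz
clamp (suc m) zero    = fz
clamp (suc m) (suc i) = fs (clamp m i)

clamp-toℕ : ∀ m (i : Fin (suc m)) → i ≡ clamp m (toℕ i)
clamp-toℕ zero    fz     = refl
clamp-toℕ (suc m) fz     = refl
clamp-toℕ (suc m) (fs i) = cong fs (clamp-toℕ m i)

clamp-mono : ∀ m {i j} → i ≤ j → toℕ (clamp m i) ≤ toℕ (clamp m j)
clamp-mono zero    i≤j       = z≤n
clamp-mono (suc m) {zero} i≤j = z≤n
clamp-mono (suc m) (s≤s i≤j) = s≤s (clamp-mono m i≤j)

σ-mono-⪰ : ∀ {m} (x : Fin (suc m) → ℚ) → (∀ i j → toℕ i ≤ toℕ j → x j ℚ.≤ x i) →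
  ∀ T S → T ⪰ S → σ S x ℚ.≤ σ T x
σ-mono-⪰ {m} x antitone T S T⪰S =
  subst₂ ℚ._≤_ (sym (σ≡sumMap-elems S x f x≡f)) (sym (σ≡sumMap-elems T x f x≡f))
    (sumMap-antitone f (λ i≤j → antitone _ _ (clamp-mono m i≤j)) T⪰S)
  where
  -- ⪰ compares positions in ℕ; clamping extends x to ℕ and keeps it non-increasing.
  f : ℕ → ℚ
  f = x ∘ clamp m
  x≡f : ∀ i → x i ≡ f (toℕ i)
  x≡f i = cong x (clamp-toℕ m i)

¬outside⪰inside : ∀ {m} (U S : Subset m) → ¬ (outside ∷ U) ⪰ (inside ∷ S)
¬outside⪰inside U S U⪰S with elems U | U⪰S
... | []    | ()
... | _ ∷ _ | () ∷ _

nonneg? : (k : ℕ) {n : ℕ} (x : Fin n → ℚ) → Decidable (λ T → ∣ T ∣ ≡ k × 0ℚ ℚ.≤ σ T x)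
nonneg? k x T = (∣ T ∣ ≟ k) ×-dec (0ℚ ℚ.≤? σ T x)

s≡count : ∀ k {n} (x : Fin n → ℚ) → s k x ≡ count n (nonneg? k x)
s≡count k {n} x = length-filter-kSubsets n k (λ T → 0ℚ ℚ.≤? σ T x)

IsG⇒≤s : ∀ {m′ k G} → IsG m′ k G → ∀ {m} (x : Fin m → ℚ) (W : Subset m) →
  ∣ W ∣ ≡ m′ → 0ℚ ℚ.≤ σ W x → G ≤ s k x
IsG⇒≤s {k = k} {G} (_ , minimal) {m} x W refl σW≥0 = begin
  G                                    ≤⟨ minimal y (subst (0ℚ ℚ.≤_) (sym (total-restrict W x)) σW≥0) ⟩
  s k y                                ≡⟨ s≡count k y ⟩
  count (∣ W ∣) (nonneg? k y)          ≤⟨ count-mono (∣ W ∣) _ _ lift-nonneg ⟩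
  count (∣ W ∣) (nonneg? k x ∘ lift W) ≤⟨ count-lift W (nonneg? k x) ⟩
  count m (nonneg? k x)                ≡⟨ s≡count k x ⟨
  s k x                                ∎
  where
  open ℕ.≤-Reasoning
  y = restrict W x
  lift-nonneg : ∀ U → ∣ U ∣ ≡ k × 0ℚ ℚ.≤ σ U y → ∣ lift W U ∣ ≡ k × 0ℚ ℚ.≤ σ (lift W U) x
  lift-nonneg U (∣U∣≡k , σU≥0) = trans (∣lift∣ W U) ∣U∣≡k , subst (0ℚ ℚ.≤_) (sym (σ-lift W U x)) σU≥0

L≤count-inside : ∀ {m} k (x : Fin (suc m) → ℚ) → (∀ i j → toℕ i ≤ toℕ j → x j ℚ.≤ x i) →
  (S : Subset m) → 0ℚ ℚ.≤ σ (inside ∷ S) x → L k (inside ∷ S) ≤ count m (nonneg? k x ∘ (inside ∷_))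
L≤count-inside {m} k x antitone S σS≥0 = begin
  L k (inside ∷ S)
    ≡⟨ length-filter-kSubsets (suc m) k (_⪰? (inside ∷ S)) ⟩
  count m (dominates? ∘ (inside ∷_)) ℕ.+ count m (dominates? ∘ (outside ∷_))
    ≡⟨ cong (count m (dominates? ∘ (inside ∷_)) ℕ.+_) (count-≡0 m _ (λ U → ¬outside⪰inside U S ∘ proj₂)) ⟩
  count m (dominates? ∘ (inside ∷_)) ℕ.+ 0
    ≡⟨ ℕ.+-identityʳ _ ⟩
  count m (dominates? ∘ (inside ∷_))
    ≤⟨ count-mono m _ _ (λ V → map₂ (nonneg-⪰ V)) ⟩
  count m (nonneg? k x ∘ (inside ∷_))
    ∎
  where
  open ℕ.≤-Reasoning
  dominates? : Decidable (λ T → ∣ T ∣ ≡ k × T ⪰ (inside ∷ S))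
  dominates? T = (∣ T ∣ ≟ k) ×-dec (T ⪰? (inside ∷ S))
  nonneg-⪰ : ∀ V → (inside ∷ V) ⪰ (inside ∷ S) → 0ℚ ℚ.≤ σ (inside ∷ V) x
  nonneg-⪰ V V⪰S = ℚ.≤-trans σS≥0 (σ-mono-⪰ x antitone (inside ∷ V) (inside ∷ S) V⪰S)

C≤count-inside : ∀ {m} k (x : Fin (suc m) → ℚ) →
  (∀ V → ∣ V ∣ ≡ k → 0ℚ ℚ.≤ σ (inside ∷ V) x) → m C k ≤ count m (nonneg? (suc k) x ∘ (inside ∷_))
C≤count-inside {m} k x nonneg = begin
  m C k                                     ≡⟨ count-size m k ⟨
  count m (λ V → ∣ V ∣ ≟ k)                 ≤⟨ count-mono m _ _ (λ V ∣V∣≡k → cong suc ∣V∣≡k , nonneg V ∣V∣≡k) ⟩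
  count m (nonneg? (suc k) x ∘ (inside ∷_)) ∎
  where open ℕ.≤-Reasoning

0≤x+y⇒x<0⇒0≤y : ∀ {a b : ℚ} → 0ℚ ℚ.≤ a ℚ.+ b → a ℚ.< 0ℚ → 0ℚ ℚ.≤ b
0≤x+y⇒x<0⇒0≤y {a} {b} 0≤a+b a<0 with 0ℚ ℚ.≤? b
... | yes 0≤b = 0≤b
... | no  0≰b = contradiction (ℚ.≤-<-trans 0≤a+b a+b<0) (ℚ.<-irrefl refl)
  where
  a+b<0 : a ℚ.+ b ℚ.< 0ℚ
  a+b<0 = subst (a ℚ.+ b ℚ.<_) (ℚ.+-identityˡ 0ℚ) (ℚ.+-mono-< a<0 (ℚ.≰⇒> 0≰b))

G≤count-outside : ∀ {m} k G (x : Fin (suc m) → ℚ) → IsG (m ∸ k) (suc k) G → 0ℚ ℚ.≤ total x →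
  (V : Subset m) → ∣ V ∣ ≡ k → σ (inside ∷ V) x ℚ.< 0ℚ → G ≤ count m (nonneg? (suc k) x ∘ (outside ∷_))
G≤count-outside {m} k G x isG total≥0 V ∣V∣≡k σV<0 = begin
  G                                          ≤⟨ IsG⇒≤s isG (x ∘ fs) (∁ V) ∣∁V∣≡m∸k σ∁V≥0 ⟩
  s (suc k) (x ∘ fs)                         ≡⟨ s≡count (suc k) (x ∘ fs) ⟩
  count m (nonneg? (suc k) x ∘ (outside ∷_)) ∎
  where
  open ℕ.≤-Reasoning
  ∣∁V∣≡m∸k : ∣ ∁ V ∣ ≡ m ∸ k
  ∣∁V∣≡m∸k = trans (∣∁p∣≡n∸∣p∣ V) (cong (m ∸_) ∣V∣≡k)
  σ∁V≥0 : 0ℚ ℚ.≤ σ (∁ V) (x ∘ fs)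
  σ∁V≥0 = 0≤x+y⇒x<0⇒0≤y (subst (0ℚ ℚ.≤_) (total≡σ+σ∁ (inside ∷ V) x) total≥0) σV<0

mainTheorem3 : (n k : ℕ) (t : ℤ) → 1 ≤ k → k ≤ n →
    t ≤ℤ + ((n ∸ 1) C (k ∸ 1)) →
    (S : Subset n) → ∣ S ∣ ≡ k → OneIn S →
    (G : ℕ) → IsG (n ∸ k) k G →
    t ≤ℤ (+ (L k S)) + (+ G) →
    (x : Fin n → ℚ) → InF x → + (s k x) <ℤ t → σ S x <ℚ 0ℚ
mainTheorem3 (suc m) (suc k) t (s≤s z≤n) _ t≤C (inside ∷ S) _ refl G isG t≤L+G x (total≥0 , antitone) s<t
  with σ (inside ∷ S) x ℚ.<? 0ℚ
... | yes σS<0 = σS<0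
... | no  σS≮0 = contradiction t≤s (ℤ.<⇒≱ s<t)
  where
  open ℕ.≤-Reasoning
  #inside  = count m (nonneg? (suc k) x ∘ (inside ∷_))
  #outside = count m (nonneg? (suc k) x ∘ (outside ∷_))
  t≤s : t ≤ℤ + s (suc k) x
  t≤s with anySubset? (λ V → (∣ V ∣ ≟ k) ×-dec (σ (inside ∷ V) x ℚ.<? 0ℚ))
  ... | yes (V , ∣V∣≡k , σV<0) = ℤ.≤-trans t≤L+G (+≤+ (begin
    L (suc k) (inside ∷ S) ℕ.+ G ≤⟨ ℕ.+-mono-≤ (L≤count-inside (suc k) x antitone S (ℚ.≮⇒≥ σS≮0))
                                              (G≤count-outside k G x isG total≥0 V ∣V∣≡k σV<0) ⟩
    #inside ℕ.+ #outside         ≡⟨ s≡count (suc k) x ⟨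
    s (suc k) x                  ∎))
  ... | no ∄V = ℤ.≤-trans t≤C (+≤+ (begin
    m C k                ≤⟨ C≤count-inside k x (λ V ∣V∣≡k → ℚ.≮⇒≥ (λ σV<0 → ∄V (V , ∣V∣≡k , σV<0))) ⟩
    #inside              ≤⟨ ℕ.m≤m+n #inside #outside ⟩
    #inside ℕ.+ #outside ≡⟨ s≡count (suc k) x ⟨
    s (suc k) x          ∎))
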